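{- Let $n$ be a positive integer and let $\mathcal{X},\mathcal{X}'\in\mathcal{T}_{n+1}$ be written as $\mathcal{X}=\{x_0,\dots,x_m\}\cup\mathcal{Y}_0\cup\dots\cup\mathcal{Y}_k$ and $\mathcal{X}'=\{x'_0,\dots,x'_{m'}\}\cup\mathcal{Y}'_0\cup\dots\cup\mathcal{Y}'_{k'}$ in the decomposition described below, so that $\pi(\mathcal{X})=(\tau(m,k),[\mathcal{Y}_0,\dots,\mathcal{Y}_k])$ and $\pi(\mathcal{X}')=(\tau(m',k'),[\mathcal{Y}'_0,\dots,\mathcal{Y}'_{k'}])$. If $\tau(m,k)\le_p\tau(m',k')$ and $[\mathcal{Y}_0,\dots,\mathcal{Y}_k]<<[\mathcal{Y}'_0,\dots,\mathcal{Y}'_{k'}]$ (in $(\mathcal{T}_n^\#,<<)$), then $\mathcal{X}\le_p\mathcal{X}'$. That is, $\pi\colon(\mathcal{T}_{n+1},\le_p)\to(\mathcal{T}_2,\le_p)\times(\mathcal{T}_n^\#,<<)$ is order reflecting.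
   Context: A co-tree is a poset with a greatest element in which every principal upset is a chain. The $n$-comb $\mathfrak{C}_n$ is the poset on $\{c_1,\dots,c_n,c_1',\dots,c_n'\}$ with order generated by $c_1<\dots<c_n$, $c_i'<c_i$; $\mathcal{T}_n$ is the set of finite co-trees (up to isomorphism) into which $\mathfrak{C}_n$ does not order-embed. Each $\mathcal{X}\in\mathcal{T}_{n+1}$ is written as: $x_0$ its greatest element, a chain $x_0>\dots>x_m$, the immediate predecessors $y_0,\dots,y_k$ of $x_m$, and $X=\{x_0,\dots,x_m\}\cup\mathcal{Y}_0\cup\dots\cup\mathcal{Y}_k$ with $\mathcal{Y}_i={\downarrow}y_i\in\mathcal{T}_n$ pairwise disjoint. For $m,k\in\omega$, $\tau(m,k)$ is the co-tree consisting of a chain $x_0>\dots>x_m$ whose immediate predecessors of $x_m$ are $k+1$ pairwise incomparable minimal points $y_0,\dots,y_k$. A bi-p-morphism $f\colon\mathcal{X}\to\mathcal{Y}$ is an order-preserving map such that $f(x)\le y$ implies $y=f(z)$ for some $z\ge x$, and $y\le f(x)$ implies $y=f(z)$ for some $z\le x$; $\mathcal{Y}\le_p\mathcal{X}$ iff there is a surjective bi-p-morphism $\mathcal{X}\to\mathcal{Y}$. $\mathcal{T}_n^\#$ is the set of finite multisets of $\mathcal{T}_n$ (finite lists with repetition, order irrelevant); for multisets $M,N$, $N<<M$ iff there is a surjective assignment $f$ of occurrences of $M$ to occurrences of $N$ (every occurrence of $N$ hit) with $f(p)\le_p p$ for all occurrences $p\in M$. The product order is componentwise. -}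

module Defs where

open import Data.Nat using (ℕ; suc)
open import Data.Fin using (Fin) renaming (_≤_ to _≤ᶠ_)
open import Data.Sum using (_⊎_; inj₁; inj₂)
open import Data.Product using (Σ; _×_; _,_; ∃)
open import Data.Empty using (⊥)
open import Data.Unit using (⊤)
open import Relation.Nullary using (¬_)
open import Relation.Binary.PropositionalEquality using (_≡_)
open import Function.Bundles using (_↔_)

record Ord : Set₁ where
  field
    Carrier : Set
    le      : Carrier → Carrier → Set

open Ord public

IsPartialOrder : Ord → Set
IsPartialOrder P =
  (∀ x → le P x x) ×
  (∀ x y → le P x y → le P y x → x ≡ y) ×
  (∀ x y z → le P x y → le P y z → le P x z)

IsFinite : Ord → Set
IsFinite P = Σ ℕ λ N → Carrier P ↔ Fin N

IsCoTree : Ord → Set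
IsCoTree P =
  IsPartialOrder P × IsFinite P ×
  (Σ (Carrier P) λ top → ∀ x → le P x top) ×
  (∀ x y z → le P x y → le P x z → le P y z ⊎ le P z y)

IsOrderEmbedding : (P Q : Ord) → (Carrier P → Carrier Q) → Set
IsOrderEmbedding P Q f =
  ∀ a b → (le P a b → le Q (f a) (f b)) × (le Q (f a) (f b) → le P a b)

-- The n-comb: inj₁ i = c_{i+1}, inj₂ i = c'_{i+1}; order generated by
-- c_1 < … < c_n and c'_i < c_i (reflexive-transitive closure below).

combLe : (n : ℕ) → Fin n ⊎ Fin n → Fin n ⊎ Fin n → Set
combLe n (inj₁ i) (inj₁ j) = i ≤ᶠ j
combLe n (inj₂ i) (inj₁ j) = i ≤ᶠ j
combLe n (inj₂ i) (inj₂ j) = i ≡ j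
combLe n (inj₁ i) (inj₂ j) = ⊥

Comb : ℕ → Ord
Comb n = record { Carrier = Fin n ⊎ Fin n ; le = combLe n }

T : ℕ → Ord → Set
T n P = IsCoTree P × ¬ (Σ (Carrier (Comb n) → Carrier P) (IsOrderEmbedding (Comb n) P))

IsBiP : (X Y : Ord) → (Carrier X → Carrier Y) → Set
IsBiP X Y f =
  (∀ x x′ → le X x x′ → le Y (f x) (f x′)) ×
  (∀ x y → le Y (f x) y → Σ (Carrier X) λ z → le X x z × f z ≡ y) ×
  (∀ x y → le Y y (f x) → Σ (Carrier X) λ z → le X z x × f z ≡ y)

_≤ₚ_ : Ord → Ord → Set
Y ≤ₚ X = Σ (Carrier X → Carrier Y) λ f →
  IsBiP X Y f × (∀ y → Σ (Carrier X) λ x → f x ≡ y)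

-- finite multisets of co-trees, represented as families indexed by
-- Fin (suc k) (a multiset [𝒴₀,…,𝒴ₖ]); N << M iff there is a surjective
-- assignment f of occurrences of M to occurrences of N with f(p) ≤ₚ p.

_<<_ : ∀ {k k′} → (Fin (suc k) → Ord) → (Fin (suc k′) → Ord) → Set
_<<_ {k} {k′} N M = Σ (Fin (suc k′) → Fin (suc k)) λ f →
  (∀ i → Σ (Fin (suc k′)) λ j → f j ≡ i) × (∀ j → N (f j) ≤ₚ M j)

-- τ(m,k): chain x₀ > … > xₘ (inj₁ i = xᵢ) with k+1 pairwise incomparable
-- minimal points y₀,…,yₖ (inj₂ a = y_a) as immediate predecessors of xₘ.

tauLe : (m k : ℕ) → Fin (suc m) ⊎ Fin (suc k) → Fin (suc m) ⊎ Fin (suc k) → Set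
tauLe m k (inj₁ i) (inj₁ j) = j ≤ᶠ i
tauLe m k (inj₂ a) (inj₁ j) = ⊤
tauLe m k (inj₂ a) (inj₂ b) = a ≡ b
tauLe m k (inj₁ i) (inj₂ b) = ⊥

τ : ℕ → ℕ → Ord
τ m k = record { Carrier = Fin (suc m) ⊎ Fin (suc k) ; le = tauLe m k }

-- The decomposition 𝒳 = {x₀,…,xₘ} ∪ 𝒴₀ ∪ … ∪ 𝒴ₖ: a chain x₀ > … > xₘ
-- (inj₁ i = xᵢ) with the pairwise disjoint co-trees 𝒴ᵢ placed below xₘ
-- (so their greatest elements yᵢ are the immediate predecessors of xₘ).

GlueCarrier : (m k : ℕ) → (Fin (suc k) → Ord) → Set
GlueCarrier m k Ys = Fin (suc m) ⊎ Σ (Fin (suc k)) λ i → Carrier (Ys i)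

data GlueLe (m k : ℕ) (Ys : Fin (suc k) → Ord) :
       GlueCarrier m k Ys → GlueCarrier m k Ys → Set where
  chain  : ∀ {i j} → j ≤ᶠ i → GlueLe m k Ys (inj₁ i) (inj₁ j)
  below  : ∀ {p j} → GlueLe m k Ys (inj₂ p) (inj₁ j)
  inside : ∀ {i a b} → le (Ys i) a b → GlueLe m k Ys (inj₂ (i , a)) (inj₂ (i , b))

Glue : (m k : ℕ) → (Fin (suc k) → Ord) → Ord
Glue m k Ys = record { Carrier = GlueCarrier m k Ys ; le = GlueLe m k Ys }

{-# OPTIONS --safe #-}
module Submission where

-- A surjective bi-p-morphism sends minimal points to minimal points, so the
-- leaves of τ(m′,k′) cannot cover the chain of τ(m,k); its m+1 chain points
-- therefore have distinct preimages on the chain of τ(m′,k′), and m ≤ m′.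
-- The required map 𝒳′ → 𝒳 then sends each piece 𝒴′ⱼ onto 𝒴_{f(j)} by the
-- maps witnessing << and collapses the chain x′₀ > … > x′_{m′} onto
-- x₀ > … > xₘ by i ↦ min(i, m); it is the composite of these two surjective
-- bi-p-morphisms.

open import Defs
open import Data.Nat using (ℕ; suc; _≤_; _<_; _⊓_; _⊔_; s≤s; s≤s⁻¹)
open import Data.Nat.Properties
  using (≤-trans; ⊓-monoˡ-≤; m⊓n≤m; m⊓n≤n; m≤m⊔n; ⊔-lub; ⊓-distribʳ-⊔; m≤n⇒m⊓n≡m; m≤n⇒m⊔n≡n; module ≤-Reasoning)
open import Data.Fin using (Fin; zero; toℕ; fromℕ<; inject≤) renaming (_≤_ to _≤ᶠ_)
open import Data.Fin.Properties using (toℕ-fromℕ<; toℕ-injective; toℕ-inject≤; toℕ<n; injective⇒≤)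
open import Data.Sum using (inj₁; inj₂)
open import Data.Sum.Properties using (inj₁-injective)
open import Data.Product using (Σ; _×_; _,_; proj₁; proj₂)
open import Data.Unit using (tt)
open import Data.Empty using (⊥-elim)
open import Function using (_∘_; case_of_)
open import Relation.Binary.PropositionalEquality
  using (_≡_; _≢_; refl; sym; trans; cong; subst; subst₂; module ≡-Reasoning)

IsBiP-∘ : ∀ {X Y Z : Ord} {f : Carrier Y → Carrier X} {g : Carrier Z → Carrier Y} →
          IsBiP Y X f → IsBiP Z Y g → IsBiP Z X (f ∘ g)
IsBiP-∘ {X} {Y} {Z} {f} {g} (f-mono , f-up , f-down) (g-mono , g-up , g-down) = mono , up , down
  where
  mono : ∀ z z′ → le Z z z′ → le X (f (g z)) (f (g z′))
  mono z z′ z≤z′ = f-mono _ _ (g-mono z z′ z≤z′)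

  up : ∀ z x → le X (f (g z)) x → Σ (Carrier Z) λ w → le Z z w × f (g w) ≡ x
  up z x fgz≤x with f-up (g z) x fgz≤x
  ... | y , gz≤y , fy≡x with g-up z y gz≤y
  ...   | w , z≤w , gw≡y = w , z≤w , trans (cong f gw≡y) fy≡x

  down : ∀ z x → le X x (f (g z)) → Σ (Carrier Z) λ w → le Z w z × f (g w) ≡ x
  down z x x≤fgz with f-down (g z) x x≤fgz
  ... | y , y≤gz , fy≡x with g-down z y y≤gz
  ...   | w , w≤z , gw≡y = w , w≤z , trans (cong f gw≡y) fy≡x

≤ₚ-trans : ∀ {X Y Z : Ord} → X ≤ₚ Y → Y ≤ₚ Z → X ≤ₚ Z
≤ₚ-trans {X} {Y} {Z} (f , f-biP , f-onto) (g , g-biP , g-onto) = f ∘ g , IsBiP-∘ {X} {Y} {Z} f-biP g-biP , onto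
  where
  onto : ∀ x → Σ (Carrier Z) λ z → f (g z) ≡ x
  onto x with f-onto x
  ... | y , fy≡x with g-onto y
  ...   | z , gz≡y = z , trans (cong f gz≡y) fy≡x

Minimal : (P : Ord) → Carrier P → Set
Minimal P x = ∀ y → le P y x → y ≡ x

IsBiP-preserves-Minimal : ∀ {X Y : Ord} {f : Carrier X → Carrier Y} {x : Carrier X} →
                          IsBiP X Y f → Minimal X x → Minimal Y (f x)
IsBiP-preserves-Minimal {f = f} (_ , _ , f-down) x-min y y≤fx with f-down _ y y≤fx
... | z , z≤x , fz≡y = trans (sym fz≡y) (cong f (x-min z z≤x))

τ-leaf-minimal : ∀ {m k} b → Minimal (τ m k) (inj₂ b)
τ-leaf-minimal b (inj₂ .b) refl = refl

τ-≤ₚ⇒≤ : ∀ {m k m′ k′} → τ m k ≤ₚ τ m′ k′ → m ≤ m′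
τ-≤ₚ⇒≤ {m} {k} {m′} {k′} (g , g-biP , g-onto) = s≤s⁻¹ (injective⇒≤ chain-preimage-injective)
  where
  leaf↛chain : ∀ b i → g (inj₂ b) ≢ inj₁ i
  leaf↛chain b i gb≡i =
    case trans (IsBiP-preserves-Minimal {τ m′ k′} {τ m k} g-biP (τ-leaf-minimal b) (inj₂ zero) y₀≤gb) gb≡i of λ ()
    where
    y₀≤gb : tauLe m k (inj₂ zero) (g (inj₂ b))
    y₀≤gb = subst (tauLe m k (inj₂ zero)) (sym gb≡i) tt

  chain-preimage : ∀ i → Σ (Fin (suc m′)) λ j → g (inj₁ j) ≡ inj₁ i
  chain-preimage i with g-onto (inj₁ i)
  ... | inj₁ j , gj≡i = j , gj≡i
  ... | inj₂ b , gb≡i = ⊥-elim (leaf↛chain b i gb≡i)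

  chain-preimage-injective : ∀ {i i′} → proj₁ (chain-preimage i) ≡ proj₁ (chain-preimage i′) → i ≡ i′
  chain-preimage-injective {i} {i′} j≡j′ = inj₁-injective (begin
    inj₁ i                               ≡⟨ sym (proj₂ (chain-preimage i)) ⟩
    g (inj₁ (proj₁ (chain-preimage i)))  ≡⟨ cong (g ∘ inj₁) j≡j′ ⟩
    g (inj₁ (proj₁ (chain-preimage i′))) ≡⟨ proj₂ (chain-preimage i′) ⟩
    inj₁ i′                              ∎)
    where open ≡-Reasoning

module Clamp {m m′ : ℕ} (m≤m′ : m ≤ m′) where

  clamp : Fin (suc m′) → Fin (suc m)
  clamp i = fromℕ< (s≤s (m⊓n≤n (toℕ i) m))

  embed : Fin (suc m) → Fin (suc m′)
  embed j = inject≤ j (s≤s m≤m′)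

  toℕ-clamp : ∀ i → toℕ (clamp i) ≡ toℕ i ⊓ m
  toℕ-clamp i = toℕ-fromℕ< (s≤s (m⊓n≤n (toℕ i) m))

  toℕ≤m : ∀ (j : Fin (suc m)) → toℕ j ≤ m
  toℕ≤m j = s≤s⁻¹ (toℕ<n j)

  clamp-embed : ∀ j → clamp (embed j) ≡ j
  clamp-embed j = toℕ-injective (begin
    toℕ (clamp (embed j)) ≡⟨ toℕ-clamp (embed j) ⟩
    toℕ (embed j) ⊓ m     ≡⟨ cong (_⊓ m) (toℕ-inject≤ j (s≤s m≤m′)) ⟩
    toℕ j ⊓ m             ≡⟨ m≤n⇒m⊓n≡m (toℕ≤m j) ⟩
    toℕ j                 ∎)
    where open ≡-Reasoning

  clamp-mono : ∀ {i i′} → i ≤ᶠ i′ → clamp i ≤ᶠ clamp i′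
  clamp-mono {i} {i′} i≤i′ = subst₂ _≤_ (sym (toℕ-clamp i)) (sym (toℕ-clamp i′)) (⊓-monoˡ-≤ m i≤i′)

  ≤-clamp⇒embed-≤ : ∀ {j i} → j ≤ᶠ clamp i → embed j ≤ᶠ i
  ≤-clamp⇒embed-≤ {j} {i} j≤ci = begin
    toℕ (embed j)   ≡⟨ toℕ-inject≤ j (s≤s m≤m′) ⟩
    toℕ j           ≤⟨ j≤ci ⟩
    toℕ (clamp i)   ≡⟨ toℕ-clamp i ⟩
    toℕ i ⊓ m       ≤⟨ m⊓n≤m (toℕ i) m ⟩
    toℕ i           ∎
    where open ≤-Reasoning

  -- The lift is max(i, j): clamping distributes over max and fixes j.
  clamp-≤⇒lift : ∀ {i j} → clamp i ≤ᶠ j → Σ (Fin (suc m′)) λ w → i ≤ᶠ w × clamp w ≡ j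
  clamp-≤⇒lift {i} {j} ci≤j = w , i≤w , toℕ-injective clamp-w≡j
    where
    i⊔j<1+m′ : toℕ i ⊔ toℕ j < suc m′
    i⊔j<1+m′ = s≤s (⊔-lub (s≤s⁻¹ (toℕ<n i)) (≤-trans (toℕ≤m j) m≤m′))

    w : Fin (suc m′)
    w = fromℕ< i⊔j<1+m′

    i≤w : i ≤ᶠ w
    i≤w = subst (toℕ i ≤_) (sym (toℕ-fromℕ< i⊔j<1+m′)) (m≤m⊔n (toℕ i) (toℕ j))

    clamp-w≡j : toℕ (clamp w) ≡ toℕ j
    clamp-w≡j = begin
      toℕ (clamp w)               ≡⟨ toℕ-clamp w ⟩
      toℕ w ⊓ m                   ≡⟨ cong (_⊓ m) (toℕ-fromℕ< i⊔j<1+m′) ⟩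
      (toℕ i ⊔ toℕ j) ⊓ m         ≡⟨ ⊓-distribʳ-⊔ m (toℕ i) (toℕ j) ⟩
      (toℕ i ⊓ m) ⊔ (toℕ j ⊓ m)   ≡⟨ cong ((toℕ i ⊓ m) ⊔_) (m≤n⇒m⊓n≡m (toℕ≤m j)) ⟩
      (toℕ i ⊓ m) ⊔ toℕ j         ≡⟨ m≤n⇒m⊔n≡n (subst (_≤ toℕ j) (toℕ-clamp i) ci≤j) ⟩
      toℕ j                       ∎
      where open ≡-Reasoning

Glue-≤ₚ-chain : ∀ {m m′ k} {Ys : Fin (suc k) → Ord} → m ≤ m′ → Glue m k Ys ≤ₚ Glue m′ k Ys
Glue-≤ₚ-chain {m} {m′} {k} {Ys} m≤m′ = F , (mono , up , down) , onto
  where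
  open Clamp m≤m′

  F : GlueCarrier m′ k Ys → GlueCarrier m k Ys
  F (inj₁ i) = inj₁ (clamp i)
  F (inj₂ p) = inj₂ p

  mono : ∀ x x′ → GlueLe m′ k Ys x x′ → GlueLe m k Ys (F x) (F x′)
  mono (inj₁ _) (inj₁ _) (chain j≤i)  = chain (clamp-mono j≤i)
  mono (inj₂ _) (inj₁ _) below        = below
  mono (inj₂ _) (inj₂ _) (inside a≤b) = inside a≤b

  up : ∀ x y → GlueLe m k Ys (F x) y → Σ (GlueCarrier m′ k Ys) λ z → GlueLe m′ k Ys x z × F z ≡ y
  up (inj₁ _) (inj₁ j) (chain j≤ci) = inj₁ (embed j) , chain (≤-clamp⇒embed-≤ j≤ci) , cong inj₁ (clamp-embed j)
  up (inj₂ _) (inj₁ j) below        = inj₁ (embed j) , below , cong inj₁ (clamp-embed j)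
  up (inj₂ _) (inj₂ q) (inside a≤b) = inj₂ q , inside a≤b , refl

  down : ∀ x y → GlueLe m k Ys y (F x) → Σ (GlueCarrier m′ k Ys) λ z → GlueLe m′ k Ys z x × F z ≡ y
  down (inj₁ _) (inj₁ _) (chain ci≤j) with clamp-≤⇒lift ci≤j
  ... | w , i≤w , cw≡j = inj₁ w , chain i≤w , cong inj₁ cw≡j
  down (inj₁ _) (inj₂ q) below        = inj₂ q , below , refl
  down (inj₂ _) (inj₂ q) (inside b≤a) = inj₂ q , inside b≤a , refl

  onto : ∀ y → Σ (GlueCarrier m′ k Ys) λ x → F x ≡ y
  onto (inj₁ j) = inj₁ (embed j) , cong inj₁ (clamp-embed j)
  onto (inj₂ q) = inj₂ q , refl

Glue-≤ₚ-pieces : ∀ {m k k′} {Ys : Fin (suc k) → Ord} {Ys′ : Fin (suc k′) → Ord} →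
                 Ys << Ys′ → Glue m k Ys ≤ₚ Glue m k′ Ys′
Glue-≤ₚ-pieces {m} {k} {k′} {Ys} {Ys′} (f , f-onto , Ys≤ₚYs′) = F , (mono , up , down) , onto
  where
  h : ∀ j → Carrier (Ys′ j) → Carrier (Ys (f j))
  h j = proj₁ (Ys≤ₚYs′ j)

  h-biP : ∀ j → IsBiP (Ys′ j) (Ys (f j)) (h j)
  h-biP j = proj₁ (proj₂ (Ys≤ₚYs′ j))

  h-onto : ∀ j b → Σ (Carrier (Ys′ j)) λ a → h j a ≡ b
  h-onto j = proj₂ (proj₂ (Ys≤ₚYs′ j))

  F : GlueCarrier m k′ Ys′ → GlueCarrier m k Ys
  F (inj₁ i)       = inj₁ i
  F (inj₂ (j , a)) = inj₂ (f j , h j a)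

  F-inside : ∀ {j a b} → h j a ≡ b → F (inj₂ (j , a)) ≡ inj₂ (f j , b)
  F-inside = cong (inj₂ ∘ (_ ,_))

  mono : ∀ x x′ → GlueLe m k′ Ys′ x x′ → GlueLe m k Ys (F x) (F x′)
  mono (inj₁ _) (inj₁ _) (chain j≤i)               = chain j≤i
  mono (inj₂ _) (inj₁ _) below                     = below
  mono (inj₂ (j , a)) (inj₂ (.j , b)) (inside a≤b) = inside (proj₁ (h-biP j) a b a≤b)

  up : ∀ x y → GlueLe m k Ys (F x) y → Σ (GlueCarrier m k′ Ys′) λ z → GlueLe m k′ Ys′ x z × F z ≡ y
  up (inj₁ _) (inj₁ j) (chain j≤i) = inj₁ j , chain j≤i , refl
  up (inj₂ _) (inj₁ j) below       = inj₁ j , below , refl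
  up (inj₂ (j , a)) (inj₂ (_ , b)) (inside ha≤b) with proj₁ (proj₂ (h-biP j)) a b ha≤b
  ... | c , a≤c , hc≡b = inj₂ (j , c) , inside a≤c , F-inside hc≡b

  down : ∀ x y → GlueLe m k Ys y (F x) → Σ (GlueCarrier m k′ Ys′) λ z → GlueLe m k′ Ys′ z x × F z ≡ y
  down (inj₁ _) (inj₁ j) (chain i≤j) = inj₁ j , chain i≤j , refl
  down (inj₁ _) (inj₂ (i , b)) below with f-onto i
  ... | j , refl with h-onto j b
  ...   | a , ha≡b = inj₂ (j , a) , below , F-inside ha≡b
  down (inj₂ (j , a)) (inj₂ (_ , b)) (inside b≤ha) with proj₂ (proj₂ (h-biP j)) a b b≤ha
  ... | c , c≤a , hc≡b = inj₂ (j , c) , inside c≤a , F-inside hc≡b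

  onto : ∀ y → Σ (GlueCarrier m k′ Ys′) λ x → F x ≡ y
  onto (inj₁ i) = inj₁ i , refl
  onto (inj₂ (i , b)) with f-onto i
  ... | j , refl with h-onto j b
  ...   | a , ha≡b = inj₂ (j , a) , F-inside ha≡b

lemma4p8 : (n : ℕ) → 1 ≤ n →
    (m k m′ k′ : ℕ) →
    (Ys : Fin (suc k) → Ord) → (Ys′ : Fin (suc k′) → Ord) →
    (∀ i → T n (Ys i)) → (∀ j → T n (Ys′ j)) →
    T (suc n) (Glue m k Ys) → T (suc n) (Glue m′ k′ Ys′) →
    τ m k ≤ₚ τ m′ k′ →
    Ys << Ys′ →
    Glue m k Ys ≤ₚ Glue m′ k′ Ys′
lemma4p8 _ _ m k m′ k′ Ys Ys′ _ _ _ _ τ≤τ′ Ys<<Ys′ =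
  ≤ₚ-trans {Glue m k Ys} {Glue m k′ Ys′} {Glue m′ k′ Ys′}
    (Glue-≤ₚ-pieces Ys<<Ys′) (Glue-≤ₚ-chain (τ-≤ₚ⇒≤ τ≤τ′))
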